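{- Let $G$ be a connected graph of order $n\geq 4$ with $F_{xt}(G)=2$. Then each class of every fixatic partition of $V(G)$ into $2$ classes induces an edge (i.e. a subgraph isomorphic to $K_2$) if and only if $G\in\{C_4,K_{2,2},K_1+P_3,K_4-e\}$, where $K_4-e$ is the graph obtained from $K_4$ by deleting one edge and $K_1+P_3$ is the join of $K_1$ and the path $P_3$.
   Context: All graphs are finite, simple; throughout the paper graphs are assumed connected and symmetric (nontrivial automorphism group). A fixing set of $G$ is a set $F\subseteq V(G)$ such that the only automorphism fixing every vertex of $F$ is the identity. A fixatic partition of $G$ is a partition of $V(G)$ into classes each of which is a fixing set; $F_{xt}(G)$ is the maximum number of classes in a fixatic partition. The join $H_1+H_2$ is $H_1\cup H_2$ plus all edges between $V(H_1)$ and $V(H_2)$. -}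

module Defs where

open import Data.Nat using (ℕ; zero; suc; _+_; _≤_)
open import Data.Fin using (Fin; zero; suc; splitAt)
open import Data.Fin.Permutation using (Permutation; Permutation′; _⟨$⟩ʳ_)
open import Data.Bool using (Bool; true; false)
open import Data.Sum using (_⊎_; inj₁; inj₂)
open import Data.Product using (Σ; ∃; _×_; _,_; proj₁)
open import Function.Bundles using (_⇔_)
open import Relation.Binary.PropositionalEquality using (_≡_; _≢_; refl)

record Graph (n : ℕ) : Set where
  field
    adj    : Fin n → Fin n → Bool
    sym    : ∀ u v → adj u v ≡ adj v u
    irrefl : ∀ v → adj v v ≡ false
open Graph public

module _ {n : ℕ} (G : Graph n) where

  data Reach : Fin n → Fin n → Set where
    here : ∀ {v} → Reach v v
    step : ∀ {u v w} → adj G u v ≡ true → Reach v w → Reach u w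

  Connected : Set
  Connected = ∀ u v → Reach u v

  IsAutomorphism : Permutation′ n → Set
  IsAutomorphism σ = ∀ u v → adj G (σ ⟨$⟩ʳ u) (σ ⟨$⟩ʳ v) ≡ adj G u v

  IsSymmetric : Set
  IsSymmetric = Σ (Permutation′ n) λ σ → IsAutomorphism σ × ∃ λ v → σ ⟨$⟩ʳ v ≢ v

  IsFixingSet : (Fin n → Set) → Set
  IsFixingSet F = ∀ (σ : Permutation′ n) → IsAutomorphism σ →
                  (∀ v → F v → σ ⟨$⟩ʳ v ≡ v) → ∀ v → σ ⟨$⟩ʳ v ≡ v

  -- a fixatic partition into k classes: a surjective class assignment
  -- c : V(G) → Fin k (so all k classes are nonempty) each class being a
  -- fixing set
  FixaticPartition : ℕ → Set
  FixaticPartition k = Σ (Fin n → Fin k) λ c →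
      (∀ i → ∃ λ v → c v ≡ i) × (∀ i → IsFixingSet (λ v → c v ≡ i))

  FxtIs : ℕ → Set
  FxtIs m = FixaticPartition m × (∀ k → FixaticPartition k → k ≤ m)

  InducesK2 : (Fin n → Set) → Set
  InducesK2 S = ∃ λ u → ∃ λ v → u ≢ v × adj G u v ≡ true ×
                (∀ w → S w ⇔ (w ≡ u ⊎ w ≡ v))

_≅_ : ∀ {n m} → Graph n → Graph m → Set
_≅_ {n} {m} G H = Σ (Permutation n m) λ f →
  ∀ u v → adj H (f ⟨$⟩ʳ u) (f ⟨$⟩ʳ v) ≡ adj G u v

Empty : (k : ℕ) → Graph k
Empty k = record { adj = λ _ _ → false ; sym = λ _ _ → refl ; irrefl = λ _ → refl }

-- join H₁ + H₂ on Fin (a + b): first a vertices from H₁, last b from H₂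
module _ {a b : ℕ} (H₁ : Graph a) (H₂ : Graph b) where
  private
    adjSum : Fin a ⊎ Fin b → Fin a ⊎ Fin b → Bool
    adjSum (inj₁ x) (inj₁ y) = adj H₁ x y
    adjSum (inj₂ x) (inj₂ y) = adj H₂ x y
    adjSum (inj₁ _) (inj₂ _) = true
    adjSum (inj₂ _) (inj₁ _) = true

    adjSumSym : ∀ p q → adjSum p q ≡ adjSum q p
    adjSumSym (inj₁ x) (inj₁ y) = sym H₁ x y
    adjSumSym (inj₂ x) (inj₂ y) = sym H₂ x y
    adjSumSym (inj₁ _) (inj₂ _) = refl
    adjSumSym (inj₂ _) (inj₁ _) = refl

    adjSumIrr : ∀ p → adjSum p p ≡ false
    adjSumIrr (inj₁ x) = irrefl H₁ x
    adjSumIrr (inj₂ x) = irrefl H₂ x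

  join : Graph (a + b)
  join = record
    { adj    = λ u v → adjSum (splitAt a u) (splitAt a v)
    ; sym    = λ u v → adjSumSym (splitAt a u) (splitAt a v)
    ; irrefl = λ v → adjSumIrr (splitAt a v) }

private
  pattern v0 = zero
  pattern v1 = suc zero
  pattern v2 = suc (suc zero)
  pattern v3 = suc (suc (suc zero))

K1 : Graph 1
K1 = Empty 1

P3 : Graph 3
P3 = record { adj = a ; sym = s ; irrefl = i }
  where
  a : Fin 3 → Fin 3 → Bool
  a v0 v1 = true
  a v1 v0 = true
  a v1 v2 = true
  a v2 v1 = true
  a _ _ = false
  s : ∀ u v → a u v ≡ a v u
  s v0 v0 = refl
  s v0 v1 = refl
  s v0 v2 = refl
  s v1 v0 = refl
  s v1 v1 = refl
  s v1 v2 = refl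
  s v2 v0 = refl
  s v2 v1 = refl
  s v2 v2 = refl
  i : ∀ v → a v v ≡ false
  i v0 = refl
  i v1 = refl
  i v2 = refl

C4 : Graph 4
C4 = record { adj = a ; sym = s ; irrefl = i }
  where
  a : Fin 4 → Fin 4 → Bool
  a v0 v1 = true
  a v1 v0 = true
  a v1 v2 = true
  a v2 v1 = true
  a v2 v3 = true
  a v3 v2 = true
  a v3 v0 = true
  a v0 v3 = true
  a _ _ = false
  s : ∀ u v → a u v ≡ a v u
  s v0 v0 = refl
  s v0 v1 = refl
  s v0 v2 = refl
  s v0 v3 = refl
  s v1 v0 = refl
  s v1 v1 = refl
  s v1 v2 = refl
  s v1 v3 = refl
  s v2 v0 = refl
  s v2 v1 = refl
  s v2 v2 = refl
  s v2 v3 = refl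
  s v3 v0 = refl
  s v3 v1 = refl
  s v3 v2 = refl
  s v3 v3 = refl
  i : ∀ v → a v v ≡ false
  i v0 = refl
  i v1 = refl
  i v2 = refl
  i v3 = refl

K4-e : Graph 4
K4-e = record { adj = a ; sym = s ; irrefl = i }
  where
  a : Fin 4 → Fin 4 → Bool
  a v0 v0 = false
  a v1 v1 = false
  a v2 v2 = false
  a v3 v3 = false
  a v0 v2 = false
  a v2 v0 = false
  a _ _ = true
  s : ∀ u v → a u v ≡ a v u
  s v0 v0 = refl
  s v0 v1 = refl
  s v0 v2 = refl
  s v0 v3 = refl
  s v1 v0 = refl
  s v1 v1 = refl
  s v1 v2 = refl
  s v1 v3 = refl
  s v2 v0 = refl
  s v2 v1 = refl
  s v2 v2 = refl
  s v2 v3 = refl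
  s v3 v0 = refl
  s v3 v1 = refl
  s v3 v2 = refl
  s v3 v3 = refl
  i : ∀ v → a v v ≡ false
  i v0 = refl
  i v1 = refl
  i v2 = refl
  i v3 = refl

K22 : Graph 4
K22 = join (Empty 2) (Empty 2)

K1+P3 : Graph 4
K1+P3 = join K1 P3

module Submission where

-- Call the left-hand side of the equivalence the K₂-property.  If it holds, the
-- fixatic 2-partition given by F_xt = 2 has two classes that are edges; their four
-- endpoints cover V(G), so n = 4.  Every notion in the theorem is invariant under
-- isomorphism, and a graph on four vertices is isomorphic to one of the 64 labelled graphs
-- given by a table of its six potential edges.  For each table a finite certificate is
-- found by evaluating a decision procedure: the graph is disconnected (a 2-colouring
-- constant along edges), or no 2-partition is fixatic (a transposition automorphism fixes
-- a class), or some fixatic 2-partition has a class that is not an edge, or a transposition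
-- relabels it as one of C₄, K₂,₂, K₁ + P₃, K₄ − e.  Conversely, in each of these four
-- graphs every 2-partition is either not fixatic or splits into two edges.

open import Defs
open import Data.Nat using (ℕ; zero; suc; _≤_; _*_)
open import Data.Nat.Properties using (≤-antisym)
open import Data.Fin using (Fin; zero; suc; _≟_; combine)
open import Data.Fin.Properties using (all?; any?; injective⇒≤; combine-injective)
open import Data.Fin.Permutation
  using (Permutation; Permutation′; _⟨$⟩ʳ_; _⟨$⟩ˡ_; inverseˡ; inverseʳ; transpose; _∘ₚ_; flip)
  renaming (id to idₚ)
open import Data.Vec.Functional using ([]; _∷_)
open import Data.Bool using (Bool; true; false)
import Data.Bool.Properties as Bool
open import Data.Sum using (_⊎_; inj₁; inj₂) renaming (map to ⊎-map)
open import Data.Product using (∃; ∃₂; _×_; _,_; proj₁; proj₂)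
open import Function using (_∘_)
open import Function.Bundles using (_⇔_; mk⇔; Equivalence)
open import Data.Empty using (⊥-elim)
open import Relation.Nullary using (¬_; Dec)
open import Relation.Nullary.Decidable using (_×-dec_; _⊎-dec_; _→-dec_; ¬?; map′; from-yes)
open import Relation.Binary.PropositionalEquality
  using (_≡_; _≢_; _≗_; refl; trans; cong; cong₂; subst; subst₂; module ≡-Reasoning)
  renaming (sym to ≡-sym)

private
  variable
    n m k : ℕ

Class : (Fin n → Fin k) → Fin k → Fin n → Set
Class c i v = c v ≡ i

AllClassesK2 : Graph n → Set
AllClassesK2 G = ∀ (P : FixaticPartition G 2) (i : Fin 2) → InducesK2 G (Class (proj₁ P) i)

Listed : Graph n → Set
Listed G = G ≅ C4 ⊎ G ≅ K22 ⊎ G ≅ K1+P3 ⊎ G ≅ K4-e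

-- (1) Isomorphism invariance

module _ {G : Graph n} {H : Graph m} where

  ≅-sym : G ≅ H → H ≅ G
  ≅-sym (f , pres) = flip f , λ u v → begin
      adj G (f ⟨$⟩ˡ u) (f ⟨$⟩ˡ v)                       ≡⟨ pres _ _ ⟨
      adj H (f ⟨$⟩ʳ (f ⟨$⟩ˡ u)) (f ⟨$⟩ʳ (f ⟨$⟩ˡ v))     ≡⟨ cong₂ (adj H) (inverseʳ f) (inverseʳ f) ⟩
      adj H u v                                         ∎
    where open ≡-Reasoning

  ≅-trans : {K : Graph k} → G ≅ H → H ≅ K → G ≅ K
  ≅-trans (f , pres) (g , pres′) = f ∘ₚ g , λ u v → trans (pres′ _ _) (pres u v)

  connected-transport : G ≅ H → Connected G → Connected H
  connected-transport (f , pres) conn u v =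
    subst₂ (Reach H) (inverseʳ f) (inverseʳ f) (walk (conn (f ⟨$⟩ˡ u) (f ⟨$⟩ˡ v)))
    where
    walk : ∀ {x y} → Reach G x y → Reach H (f ⟨$⟩ʳ x) (f ⟨$⟩ʳ y)
    walk here         = here
    walk (step e r)   = step (trans (pres _ _) e) (walk r)

  -- The image of a fixing set is a fixing set: conjugating an automorphism τ of H that
  -- fixes the image of F gives an automorphism σ of G fixing F, which is the identity.
  fixingSet-transport : ((f , _) : G ≅ H) {F : Fin n → Set} →
                        IsFixingSet G F → IsFixingSet H (F ∘ (f ⟨$⟩ˡ_))
  fixingSet-transport (f , pres) {F} fixing τ τ-aut τ-fixes w = begin
      τ ⟨$⟩ʳ w                          ≡⟨ cong (τ ⟨$⟩ʳ_) (inverseʳ f) ⟨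
      τ ⟨$⟩ʳ (f ⟨$⟩ʳ (f ⟨$⟩ˡ w))        ≡⟨ inverseʳ f ⟨
      f ⟨$⟩ʳ (σ ⟨$⟩ʳ (f ⟨$⟩ˡ w))        ≡⟨ cong (f ⟨$⟩ʳ_) (σ-identity (f ⟨$⟩ˡ w)) ⟩
      f ⟨$⟩ʳ (f ⟨$⟩ˡ w)                 ≡⟨ inverseʳ f ⟩
      w                                 ∎
    where
    open ≡-Reasoning
    σ : Permutation′ n
    σ = f ∘ₚ τ ∘ₚ flip f
    σ-aut : IsAutomorphism G σ
    σ-aut u v = begin
      adj G (σ ⟨$⟩ʳ u) (σ ⟨$⟩ʳ v)                 ≡⟨ pres _ _ ⟨
      adj H (f ⟨$⟩ʳ (σ ⟨$⟩ʳ u)) (f ⟨$⟩ʳ (σ ⟨$⟩ʳ v)) ≡⟨ cong₂ (adj H) (inverseʳ f) (inverseʳ f) ⟩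
      adj H (τ ⟨$⟩ʳ (f ⟨$⟩ʳ u)) (τ ⟨$⟩ʳ (f ⟨$⟩ʳ v)) ≡⟨ τ-aut _ _ ⟩
      adj H (f ⟨$⟩ʳ u) (f ⟨$⟩ʳ v)                 ≡⟨ pres u v ⟩
      adj G u v                                   ∎
    σ-fixes : ∀ v → F v → σ ⟨$⟩ʳ v ≡ v
    σ-fixes v Fv = trans (cong (f ⟨$⟩ˡ_) (τ-fixes _ (subst F (≡-sym (inverseˡ f)) Fv))) (inverseˡ f)
    σ-identity : ∀ v → σ ⟨$⟩ʳ v ≡ v
    σ-identity = fixing σ σ-aut σ-fixes

  partition-transport : G ≅ H → FixaticPartition G k → FixaticPartition H k
  partition-transport (f , pres) (c , onto , fixing) =
    c ∘ (f ⟨$⟩ˡ_) ,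
    (λ i → f ⟨$⟩ʳ proj₁ (onto i) , trans (cong c (inverseˡ f)) (proj₂ (onto i))) ,
    (λ i → fixingSet-transport (f , pres) (fixing i))

  inducesK2-transport : ((f , _) : G ≅ H) {S : Fin n → Set} →
                        InducesK2 G S → InducesK2 H (S ∘ (f ⟨$⟩ˡ_))
  inducesK2-transport (f , pres) {S} (u , v , u≢v , uv , members) =
    f ⟨$⟩ʳ u , f ⟨$⟩ʳ v ,
    (λ eq → u≢v (trans (≡-sym (inverseˡ f)) (trans (cong (f ⟨$⟩ˡ_) eq) (inverseˡ f)))) ,
    trans (pres u v) uv ,
    λ w → mk⇔ (⊎-map forth forth ∘ Equivalence.to (members _))
              (Equivalence.from (members _) ∘ ⊎-map back back)
    where
    forth : ∀ {w x} → f ⟨$⟩ˡ w ≡ x → w ≡ f ⟨$⟩ʳ x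
    forth eq = trans (≡-sym (inverseʳ f)) (cong (f ⟨$⟩ʳ_) eq)
    back : ∀ {w x} → w ≡ f ⟨$⟩ʳ x → f ⟨$⟩ˡ w ≡ x
    back eq = trans (cong (f ⟨$⟩ˡ_) eq) (inverseˡ f)

inducesK2-resp : {G : Graph n} {S S′ : Fin n → Set} →
                 (∀ w → S w ⇔ S′ w) → InducesK2 G S → InducesK2 G S′
inducesK2-resp S⇔S′ (u , v , u≢v , uv , members) =
  u , v , u≢v , uv ,
  λ w → mk⇔ (Equivalence.to (members w) ∘ Equivalence.from (S⇔S′ w))
            (Equivalence.to (S⇔S′ w) ∘ Equivalence.from (members w))

-- The K₂-property is invariant under isomorphism: pull a partition of H back to G,
-- use the property there and push the resulting edge forward again.
allClassesK2-transport : {G : Graph n} {H : Graph m} → G ≅ H → AllClassesK2 G → AllClassesK2 H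
allClassesK2-transport {G = G} {H} (f , pres) allK2 P i =
  inducesK2-resp {G = H} (λ w → mk⇔ (trans (cong (proj₁ P) (≡-sym (inverseʳ f))))
                            (trans (cong (proj₁ P) (inverseʳ f))))
    (inducesK2-transport {G = G} {H} (f , pres)
      (allK2 (partition-transport {G = H} {G} (≅-sym {G = G} {H} (f , pres)) P) i))

listed-transport : {G : Graph n} {H : Graph m} → G ≅ H → Listed H → Listed G
listed-transport {G = G} {H} iso = ⊎-map (via C4) (⊎-map (via K22) (⊎-map (via K1+P3) (via K4-e)))
  where
  via : (K : Graph 4) → H ≅ K → G ≅ K
  via K = ≅-trans {G = G} {H} {K = K} iso

-- (2) A partition into induced edges has at most two vertices per class

endpoints : (G : Graph n) {S : Fin n → Set} → InducesK2 G S → Fin 2 → Fin n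
endpoints G (u , v , _) = u ∷ v ∷ []

endpoint-of : (G : Graph n) {S : Fin n → Set} (K : InducesK2 G S) {w : Fin n} →
              S w → ∃ λ b → endpoints G K b ≡ w
endpoint-of G (u , v , _ , _ , members) {w} Sw with Equivalence.to (members w) Sw
... | inj₁ w≡u = zero , ≡-sym w≡u
... | inj₂ w≡v = suc zero , ≡-sym w≡v

-- If every class of a k-colouring induces an edge then n ≤ 2k: a vertex is coded
-- injectively by its colour together with its position in the edge of that colour.
order-bound : {G : Graph n} (c : Fin n → Fin k) → (∀ i → InducesK2 G (Class c i)) → n ≤ k * 2
order-bound {n} {k} {G} c edge = injective⇒≤ code-injective
  where
  position : ∀ w → ∃ λ b → endpoints G (edge (c w)) b ≡ w
  position w = endpoint-of G (edge (c w)) refl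
  code : Fin n → Fin (k * 2)
  code w = combine (c w) (proj₁ (position w))
  code-injective : ∀ {w w′} → code w ≡ code w′ → w ≡ w′
  code-injective {w} {w′} eq with combine-injective (c w) _ (c w′) _ eq
  ... | same-colour , same-position = begin
      w                                                  ≡⟨ proj₂ (position w) ⟨
      endpoints G (edge (c w)) (proj₁ (position w))        ≡⟨ cong₂ (λ i → endpoints G (edge i)) same-colour same-position ⟩
      endpoints G (edge (c w′)) (proj₁ (position w′))      ≡⟨ proj₂ (position w′) ⟩
      w′                                                 ∎
    where open ≡-Reasoning

-- (3) Quantifying over all maps Fin n → Fin m

Extensional : ((Fin n → Fin m) → Set) → Set
Extensional Q = ∀ {f g} → f ≗ g → Q f → Q g

-- "Q holds for all maps" and "Q holds for some map", unfolded into n nested quantifiers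
-- over the values of the map; these are decidable whenever Q is.
AllMaps : ∀ n → ((Fin n → Fin m) → Set) → Set
AllMaps zero    Q = Q []
AllMaps (suc n) Q = ∀ a → AllMaps n (λ g → Q (a ∷ g))

SomeMap : ∀ n → ((Fin n → Fin m) → Set) → Set
SomeMap zero    Q = Q []
SomeMap (suc n) Q = ∃ λ a → SomeMap n (λ g → Q (a ∷ g))

allMaps? : {Q : (Fin n → Fin m) → Set} → (∀ f → Dec (Q f)) → Dec (AllMaps n Q)
allMaps? {zero}  Q? = Q? []
allMaps? {suc n} Q? = all? λ a → allMaps? λ g → Q? (a ∷ g)

someMap? : {Q : (Fin n → Fin m) → Set} → (∀ f → Dec (Q f)) → Dec (SomeMap n Q)
someMap? {zero}  Q? = Q? []
someMap? {suc n} Q? = any? λ a → someMap? λ g → Q? (a ∷ g)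

-- Soundness: every map agrees pointwise with one of the enumerated ones.
allMaps-sound : {Q : (Fin n → Fin m) → Set} → Extensional Q → AllMaps n Q → ∀ f → Q f
allMaps-sound {zero}  resp all f = resp (λ ()) all
allMaps-sound {suc n} resp all f =
  resp head-tail (allMaps-sound (λ g≗g′ → resp (cons-cong g≗g′)) (all (f zero)) (f ∘ suc))
  where
  head-tail : (f zero ∷ f ∘ suc) ≗ f
  head-tail zero    = refl
  head-tail (suc i) = refl
  cons-cong : ∀ {a g g′} → g ≗ g′ → (a ∷ g) ≗ (a ∷ g′)
  cons-cong g≗g′ zero    = refl
  cons-cong g≗g′ (suc i) = g≗g′ i

someMap-sound : {Q : (Fin n → Fin m) → Set} → SomeMap n Q → ∃ Q
someMap-sound {zero}  some = [] , some
someMap-sound {suc n} (a , some) with someMap-sound some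
... | g , Qg = a ∷ g , Qg

-- (4) Certificates for the graph properties of the theorem

_⇔?_ : {A B : Set} → Dec A → Dec B → Dec (A ⇔ B)
a? ⇔? b? = map′ (λ (to , from) → mk⇔ to from) (λ e → Equivalence.to e , Equivalence.from e)
                 ((a? →-dec b?) ×-dec (b? →-dec a?))

module _ (G : Graph n) where

  Preserves : (Fin n → Fin n) → Set
  Preserves f = ∀ u v → adj G (f u) (f v) ≡ adj G u v

  preserves? : ∀ f → Dec (Preserves f)
  preserves? f = all? λ u → all? λ v → adj G (f u) (f v) Bool.≟ adj G u v

  FixesClass : (Fin n → Fin k) → Fin k → (Fin n → Fin n) → Set
  FixesClass c i f = ∀ v → Class c i v → f v ≡ v

  fixesClass? : (c : Fin n → Fin k) (i : Fin k) → ∀ f → Dec (FixesClass c i f)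
  fixesClass? c i f = all? λ v → (c v ≟ i) →-dec (f v ≟ v)

  Pins : (Fin n → Fin k) → Fin k → (Fin n → Fin n) → Set
  Pins c i f = Preserves f → (∀ u v → f u ≡ f v → u ≡ v) → FixesClass c i f → ∀ v → f v ≡ v

  pins? : (c : Fin n → Fin k) (i : Fin k) → ∀ f → Dec (Pins c i f)
  pins? c i f = preserves? f →-dec (all? λ u → all? λ v → (f u ≟ f v) →-dec (u ≟ v))
                             →-dec fixesClass? c i f →-dec all? λ v → f v ≟ v

  pins-extensional : (c : Fin n → Fin k) (i : Fin k) → Extensional (Pins c i)
  pins-extensional c i {f} {g} f≗g pins g-pres g-inj g-fixes v =
    trans (≡-sym (f≗g v)) (pins f-pres f-inj f-fixes v)
    where
    f-pres : Preserves f
    f-pres u v = trans (cong₂ (adj G) (f≗g u) (f≗g v)) (g-pres u v)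
    f-inj : ∀ u v → f u ≡ f v → u ≡ v
    f-inj u v eq = g-inj u v (trans (≡-sym (f≗g u)) (trans eq (f≗g v)))
    f-fixes : FixesClass c i f
    f-fixes v cv = trans (f≗g v) (g-fixes v cv)

  pinning⇒fixing : (c : Fin n → Fin k) (i : Fin k) → AllMaps n (Pins c i) →
                   IsFixingSet G (Class c i)
  pinning⇒fixing c i pinsAll σ σ-aut σ-fixes =
    allMaps-sound (pins-extensional c i) pinsAll (σ ⟨$⟩ʳ_) σ-aut σ-injective σ-fixes
    where
    σ-injective : ∀ u v → σ ⟨$⟩ʳ u ≡ σ ⟨$⟩ʳ v → u ≡ v
    σ-injective u v eq = trans (≡-sym (inverseˡ σ)) (trans (cong (σ ⟨$⟩ˡ_) eq) (inverseˡ σ))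

  MovedByTransposition : (Fin n → Fin k) → Fin k → Set
  MovedByTransposition c i = ∃₂ λ a b →
    Preserves (transpose a b ⟨$⟩ʳ_) × FixesClass c i (transpose a b ⟨$⟩ʳ_) ×
    ∃ λ v → transpose a b ⟨$⟩ʳ v ≢ v

  movedByTransposition? : (c : Fin n → Fin k) (i : Fin k) → Dec (MovedByTransposition c i)
  movedByTransposition? c i = any? λ a → any? λ b → let τ = transpose a b ⟨$⟩ʳ_ in
    preserves? τ ×-dec fixesClass? c i τ ×-dec any? λ v → ¬? (τ v ≟ v)

  moved⇒notFixing : (c : Fin n → Fin k) (i : Fin k) → MovedByTransposition c i →
                    ¬ IsFixingSet G (Class c i)
  moved⇒notFixing c i (a , b , aut , fixes , v , moved) fixing = moved (fixing (transpose a b) aut fixes v)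

  SomeClassMoved : (Fin n → Fin k) → Set
  SomeClassMoved c = ∃ λ i → MovedByTransposition c i

  someClassMoved? : (c : Fin n → Fin k) → Dec (SomeClassMoved c)
  someClassMoved? c = any? (movedByTransposition? c)

  someClassMoved-extensional : Extensional (SomeClassMoved {k = k})
  someClassMoved-extensional c≗c′ (i , a , b , aut , fixes , moved) =
    i , a , b , aut , (λ v cv → fixes v (trans (c≗c′ v) cv)) , moved

  someClassMoved⇒notFixatic : (c : Fin n → Fin k) → SomeClassMoved c →
                              ¬ (∀ i → IsFixingSet G (Class c i))
  someClassMoved⇒notFixatic c (i , moved) fixing = moved⇒notFixing c i moved (fixing i)

  inducesK2? : (c : Fin n → Fin k) (i : Fin k) → Dec (InducesK2 G (Class c i))
  inducesK2? c i = any? λ u → any? λ v →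
    ¬? (u ≟ v) ×-dec (adj G u v Bool.≟ true) ×-dec all? λ w → (c w ≟ i) ⇔? ((w ≟ u) ⊎-dec (w ≟ v))

  Separation : (Fin n → Fin 2) → Set
  Separation c = (∀ a b → adj G a b ≡ true → c a ≡ c b) × ∃₂ λ u v → c u ≢ c v

  separation? : ∀ c → Dec (Separation c)
  separation? c = (all? λ a → all? λ b → (adj G a b Bool.≟ true) →-dec (c a ≟ c b))
                  ×-dec any? λ u → any? λ v → ¬? (c u ≟ c v)

  separation⇒disconnected : ∀ c → Separation c → ¬ Connected G
  separation⇒disconnected c (constant , u , v , cu≢cv) conn = cu≢cv (along (conn u v))
    where
    along : ∀ {x y} → Reach G x y → c x ≡ c y
    along here       = refl
    along (step e r) = trans (constant _ _ e) (along r)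

  DisconnectionCertificate : Set
  DisconnectionCertificate = SomeMap n Separation

  NoFixaticCertificate : Set
  NoFixaticCertificate = AllMaps n (SomeClassMoved {k = 2})

  Counterexample : (Fin n → Fin 2) → Set
  Counterexample c =
    (∃ λ i → ¬ InducesK2 G (Class c i)) × (∀ i → ∃ λ v → c v ≡ i) × (∀ i → AllMaps n (Pins c i))

  CounterexampleCertificate : Set
  CounterexampleCertificate = SomeMap n Counterexample

  MovedOrSplit : (Fin n → Fin 2) → Set
  MovedOrSplit c = SomeClassMoved c ⊎ (∀ i → InducesK2 G (Class c i))

  K2PropertyCertificate : Set
  K2PropertyCertificate = AllMaps n MovedOrSplit

  disconnection? : Dec DisconnectionCertificate
  disconnection? = someMap? separation?

  noFixatic? : Dec NoFixaticCertificate
  noFixatic? = allMaps? someClassMoved?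

  counterexample? : Dec CounterexampleCertificate
  counterexample? = someMap? λ c →
    any? (¬? ∘ inducesK2? c) ×-dec all? (λ i → any? λ v → c v ≟ i) ×-dec all? (λ i → allMaps? (pins? c i))

  k2Property? : Dec K2PropertyCertificate
  k2Property? = allMaps? λ c → someClassMoved? c ⊎-dec all? (inducesK2? c)

  disconnection-sound : DisconnectionCertificate → ¬ Connected G
  disconnection-sound cert with someMap-sound cert
  ... | c , separation = separation⇒disconnected c separation

  noFixatic-sound : NoFixaticCertificate → ¬ FixaticPartition G 2
  noFixatic-sound cert (c , _ , fixing) =
    someClassMoved⇒notFixatic c (allMaps-sound someClassMoved-extensional cert c) fixing

  counterexample-sound : CounterexampleCertificate → ¬ AllClassesK2 G
  counterexample-sound cert allK2 with someMap-sound {Q = Counterexample} cert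
  ... | c , (i , notEdge) , onto , pinning =
    notEdge (allK2 (c , onto , λ j → pinning⇒fixing c j (pinning j)) i)

  k2Property-sound : K2PropertyCertificate → AllClassesK2 G
  k2Property-sound cert (c , _ , fixing) i with allMaps-sound movedOrSplit-extensional cert c
    where
    movedOrSplit-extensional : Extensional MovedOrSplit
    movedOrSplit-extensional c≗c′ (inj₁ moved) = inj₁ (someClassMoved-extensional c≗c′ moved)
    movedOrSplit-extensional c≗c′ (inj₂ edges) = inj₂ λ j →
      inducesK2-resp {G = G} (λ w → mk⇔ (trans (≡-sym (c≗c′ w))) (trans (c≗c′ w))) (edges j)
  ... | inj₁ moved = ⊥-elim (someClassMoved⇒notFixatic c moved fixing)
  ... | inj₂ edges = edges i

-- (5) Graphs on four vertices

Relabels : Graph n → Graph m → Permutation n m → Set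
Relabels G H σ = ∀ u v → adj H (σ ⟨$⟩ʳ u) (σ ⟨$⟩ʳ v) ≡ adj G u v

relabels? : (G : Graph n) (H : Graph m) (σ : Permutation n m) → Dec (Relabels G H σ)
relabels? G H σ = all? λ u → all? λ v → adj H (σ ⟨$⟩ʳ u) (σ ⟨$⟩ʳ v) Bool.≟ adj G u v

ListedByTransposition : Graph 4 → Set
ListedByTransposition G = ∃₂ λ a b → let τ = transpose a b in
  Relabels G C4 τ ⊎ Relabels G K22 τ ⊎ Relabels G K1+P3 τ ⊎ Relabels G K4-e τ

listedByTransposition? : (G : Graph 4) → Dec (ListedByTransposition G)
listedByTransposition? G = any? λ a → any? λ b → let τ = transpose a b in
  relabels? G C4 τ ⊎-dec relabels? G K22 τ ⊎-dec relabels? G K1+P3 τ ⊎-dec relabels? G K4-e τ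

listedByTransposition-sound : {G : Graph 4} → ListedByTransposition G → Listed G
listedByTransposition-sound (a , b , relabelling) =
  ⊎-map (τ ,_) (⊎-map (τ ,_) (⊎-map (τ ,_) (τ ,_))) relabelling
  where τ = transpose a b

Certificate : Graph 4 → Set
Certificate G = DisconnectionCertificate G ⊎ ListedByTransposition G ⊎
                NoFixaticCertificate G ⊎ CounterexampleCertificate G

certificate? : (G : Graph 4) → Dec (Certificate G)
certificate? G = disconnection? G ⊎-dec listedByTransposition? G ⊎-dec
                 noFixatic? G ⊎-dec counterexample? G

certificate-sound : {G : Graph 4} → Certificate G →
                    Connected G → FixaticPartition G 2 → AllClassesK2 G → Listed G
certificate-sound {G} (inj₁ cert) conn _ _ = ⊥-elim (disconnection-sound G cert conn)
certificate-sound {G} (inj₂ (inj₁ cert)) _ _ _ = listedByTransposition-sound {G} cert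
certificate-sound {G} (inj₂ (inj₂ (inj₁ cert))) _ P _ = ⊥-elim (noFixatic-sound G cert P)
certificate-sound {G} (inj₂ (inj₂ (inj₂ cert))) _ _ allK2 = ⊥-elim (counterexample-sound G cert allK2)

record Table : Set where
  constructor table
  field e01 e02 e03 e12 e13 e23 : Bool
open Table

private
  pattern v0 = zero
  pattern v1 = suc zero
  pattern v2 = suc (suc zero)
  pattern v3 = suc (suc (suc zero))

edge : Table → Fin 4 → Fin 4 → Bool
edge t v0 v1 = e01 t
edge t v0 v2 = e02 t
edge t v0 v3 = e03 t
edge t v1 v2 = e12 t
edge t v1 v3 = e13 t
edge t v2 v3 = e23 t
edge t v1 v0 = e01 t
edge t v2 v0 = e02 t
edge t v3 v0 = e03 t
edge t v2 v1 = e12 t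
edge t v3 v1 = e13 t
edge t v3 v2 = e23 t
edge t _  _  = false

edge-sym : ∀ t u v → edge t u v ≡ edge t v u
edge-sym t v0 v0 = refl
edge-sym t v0 v1 = refl
edge-sym t v0 v2 = refl
edge-sym t v0 v3 = refl
edge-sym t v1 v0 = refl
edge-sym t v1 v1 = refl
edge-sym t v1 v2 = refl
edge-sym t v1 v3 = refl
edge-sym t v2 v0 = refl
edge-sym t v2 v1 = refl
edge-sym t v2 v2 = refl
edge-sym t v2 v3 = refl
edge-sym t v3 v0 = refl
edge-sym t v3 v1 = refl
edge-sym t v3 v2 = refl
edge-sym t v3 v3 = refl

edge-irrefl : ∀ t v → edge t v v ≡ false
edge-irrefl t v0 = refl
edge-irrefl t v1 = refl
edge-irrefl t v2 = refl
edge-irrefl t v3 = refl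

fromTable : Table → Graph 4
fromTable t = record { adj = edge t ; sym = edge-sym t ; irrefl = edge-irrefl t }

tableOf : Graph 4 → Table
tableOf G = table (adj G v0 v1) (adj G v0 v2) (adj G v0 v3) (adj G v1 v2) (adj G v1 v3) (adj G v2 v3)

tableOf-≅ : (G : Graph 4) → G ≅ fromTable (tableOf G)
tableOf-≅ G = idₚ , same-adjacency
  where
  same-adjacency : ∀ u v → edge (tableOf G) u v ≡ adj G u v
  same-adjacency v0 v0 = ≡-sym (irrefl G v0)
  same-adjacency v1 v1 = ≡-sym (irrefl G v1)
  same-adjacency v2 v2 = ≡-sym (irrefl G v2)
  same-adjacency v3 v3 = ≡-sym (irrefl G v3)
  same-adjacency v0 v1 = refl
  same-adjacency v0 v2 = refl
  same-adjacency v0 v3 = refl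
  same-adjacency v1 v2 = refl
  same-adjacency v1 v3 = refl
  same-adjacency v2 v3 = refl
  same-adjacency v1 v0 = Graph.sym G v0 v1
  same-adjacency v2 v0 = Graph.sym G v0 v2
  same-adjacency v3 v0 = Graph.sym G v0 v3
  same-adjacency v2 v1 = Graph.sym G v1 v2
  same-adjacency v3 v1 = Graph.sym G v1 v3
  same-adjacency v3 v2 = Graph.sym G v2 v3

allBool? : {P : Bool → Set} → (∀ b → Dec (P b)) → Dec (∀ b → P b)
allBool? P? = map′ (λ (f , t) → λ { false → f ; true → t }) (λ all → all false , all true)
                   (P? false ×-dec P? true)

allTables? : {P : Table → Set} → (∀ t → Dec (P t)) → Dec (∀ t → P t)
allTables? P? = map′ (λ all t → all (e01 t) (e02 t) (e03 t) (e12 t) (e13 t) (e23 t))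
                     (λ all a b c d e f → all (table a b c d e f))
                     (allBool? λ a → allBool? λ b → allBool? λ c → allBool? λ d → allBool? λ e →
                        allBool? λ f → P? (table a b c d e f))

certificates : ∀ t → Certificate (fromTable t)
certificates = from-yes (allTables? λ t → certificate? (fromTable t))

classifyFour : (G : Graph 4) → Connected G → FixaticPartition G 2 → AllClassesK2 G → Listed G
classifyFour G conn P allK2 =
  listed-transport {G = G} {T} iso
    (certificate-sound {T} (certificates (tableOf G))
      (connected-transport {G = G} {T} iso conn)
      (partition-transport {G = G} {T} iso P)
      (allClassesK2-transport {G = G} {T} iso allK2))
  where
  T : Graph 4
  T = fromTable (tableOf G)
  iso : G ≅ T
  iso = tableOf-≅ G

certified⇒allClassesK2 : (H : Graph m) → K2PropertyCertificate H →
                         {G : Graph n} → G ≅ H → AllClassesK2 G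
certified⇒allClassesK2 H cert {G} iso =
  allClassesK2-transport {G = H} {G} (≅-sym {G = G} {H} iso) (k2Property-sound H cert)

listed⇒allClassesK2 : {G : Graph n} → Listed G → AllClassesK2 G
listed⇒allClassesK2 {G = G} (inj₁ iso) =
  certified⇒allClassesK2 C4 (from-yes (k2Property? C4)) {G} iso
listed⇒allClassesK2 {G = G} (inj₂ (inj₁ iso)) =
  certified⇒allClassesK2 K22 (from-yes (k2Property? K22)) {G} iso
listed⇒allClassesK2 {G = G} (inj₂ (inj₂ (inj₁ iso))) =
  certified⇒allClassesK2 K1+P3 (from-yes (k2Property? K1+P3)) {G} iso
listed⇒allClassesK2 {G = G} (inj₂ (inj₂ (inj₂ iso))) =
  certified⇒allClassesK2 K4-e (from-yes (k2Property? K4-e)) {G} iso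

-- F_xt(G) = 2 provides a fixatic 2-partition P.  Under the K₂-property both classes of P
-- are edges, so n ≤ 4 by the order bound, hence n = 4 and the classification applies.
-- The converse holds for the listed graphs.
mainTheorem12 : (n : ℕ) (G : Graph n) → 4 ≤ n → Connected G → IsSymmetric G → FxtIs G 2 →
    ((∀ (P : FixaticPartition G 2) (i : Fin 2) → InducesK2 G (λ v → proj₁ P v ≡ i))
    ⇔ (G ≅ C4 ⊎ G ≅ K22 ⊎ G ≅ K1+P3 ⊎ G ≅ K4-e))
mainTheorem12 n G 4≤n conn _ (P , _) = mk⇔ forward (listed⇒allClassesK2 {G = G})
  where
  fourVertices : ∀ {m} → m ≡ 4 → (H : Graph m) →
                 Connected H → FixaticPartition H 2 → AllClassesK2 H → Listed H
  fourVertices refl = classifyFour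
  forward : AllClassesK2 G → Listed G
  forward allK2 = fourVertices (≤-antisym (order-bound {G = G} (proj₁ P) (allK2 P)) 4≤n) G conn P allK2
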